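{- If a graph $G$ contains $K_h$ as a balanced minor, then $\mathrm{bcw}_1(G)\ge \min(h,(h+3)/2)$.
   Context: All graphs are finite, simple and undirected. A minor model of $H$ in $G$ is a family $(X_u)_{u\in V(H)}$ of nonempty pairwise disjoint vertex sets of $G$ such that each $G[X_u]$ is connected and for every edge $uv$ of $H$ there is an edge of $G$ between $X_u$ and $X_v$; $H$ is a balanced minor of $G$ if some minor model has all $X_u$ of equal size. For a graph $G$, a blind strategy of radius $1$ is a sequence $C_1,\dots,C_m\subseteq V(G)$ using $\max_i|C_i|$ cops, with $A_1=V(G)\setminus C_1$ and $A_{i+1}$ the set of $u\in V(G)\setminus C_{i+1}$ reachable from some vertex of $A_i$ by a path of length at most $1$ (length $0$ allowed) in $G\setminus(C_i\cap C_{i+1})$; it is winning if $A_m=\emptyset$. $\mathrm{bcw}_1(G)$ is the minimum number of cops of a winning strategy. -}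

module Defs where

open import Data.Nat using (ℕ; _⊔_)
open import Data.Fin using (Fin)
open import Data.Fin.Subset using (Subset; _∈_; _∉_; _∩_; ∣_∣)
open import Data.List using (List; []; _∷_; foldr)
open import Data.Product using (Σ; _×_; ∃; ∃-syntax)
open import Data.Sum using (_⊎_)
open import Relation.Nullary using (¬_)
open import Relation.Binary.PropositionalEquality using (_≡_)

record Graph : Set₁ where
  field
    n      : ℕ
    Adj    : Fin n → Fin n → Set
    sym    : ∀ {u v} → Adj u v → Adj v u
    irrefl : ∀ {u} → ¬ Adj u u
open Graph public

module _ (G : Graph) where
  private
    V = Fin (n G)

  -- a walk from a to b all of whose vertices lie in S (a ∈ S assumed separately)
  data PathIn (S : Subset (n G)) : V → V → Set where
    here : ∀ {a} → PathIn S a a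
    step : ∀ {a c b} → Adj G a c → c ∈ S → PathIn S c b → PathIn S a b

  Connected : Subset (n G) → Set
  Connected S = ∀ a b → a ∈ S → b ∈ S → PathIn S a b

  EdgeBetween : Subset (n G) → Subset (n G) → Set
  EdgeBetween X Y = ∃[ x ] ∃[ y ] (x ∈ X × y ∈ Y × Adj G x y)

  record KMinorModel (h : ℕ) : Set where
    field
      X         : Fin h → Subset (n G)
      nonempty  : ∀ u → ∃[ x ] (x ∈ X u)
      disjoint  : ∀ u v → ¬ (u ≡ v) → ∀ x → x ∈ X u → x ∉ X v
      connected : ∀ u → Connected (X u)
      adjacent  : ∀ u v → ¬ (u ≡ v) → EdgeBetween (X u) (X v)

  BalancedKMinor : ℕ → Set
  BalancedKMinor h = Σ (KMinorModel h) λ M →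
    ∀ u v → ∣ KMinorModel.X M u ∣ ≡ ∣ KMinorModel.X M v ∣

  -- A_{i+1} from A_i, C_i, C_{i+1}: vertices u ∉ C_{i+1} reachable from A_i by a path
  -- of length ≤ 1 in G \ (C_i ∩ C_{i+1})
  nextRegion : Subset (n G) → (V → Set) → Subset (n G) → V → Set
  nextRegion Cp A Cn u =
    u ∉ Cn × ∃[ a ] (A a × (a ≡ u ⊎ (Adj G a u × a ∉ (Cp ∩ Cn) × u ∉ (Cp ∩ Cn))))

  -- robber region A_m, given C_i, A_i and the remaining sets C_{i+1},...,C_m
  finalRegion : Subset (n G) → (V → Set) → List (Subset (n G)) → V → Set
  finalRegion Cp A []         = A
  finalRegion Cp A (Cn ∷ Cs) = finalRegion Cn (nextRegion Cp A Cn) Cs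

  -- blind strategy C_1, C_2, ..., C_m given as C_1 and the list [C_2,...,C_m]
  Winning : Subset (n G) → List (Subset (n G)) → Set
  Winning C₁ Cs = ∀ u → ¬ finalRegion C₁ (λ v → v ∉ C₁) Cs u

  copsUsed : Subset (n G) → List (Subset (n G)) → ℕ
  copsUsed C₁ Cs = foldr (λ C k → ∣ C ∣ ⊔ k) ∣ C₁ ∣ Cs

-- Let X₁ … X_h be the branch sets, all of size r + 1, and weigh a vertex set S by
-- Φ(S) = Σᵤ |S ∩ Xᵤ|.  If k < h and 2k ≤ h + 2, the robber can keep a set S of
-- possible positions with Φ(S) > (k − 1)r against any k cops.  Every branch set that
-- meets S without lying inside it has, by connectivity, a vertex outside S adjacent
-- to S; adding such vertices grows S inside its closed neighbourhood to T with
-- Φ(T) > (k − 1)r + k, and since the branch sets are disjoint, the next k cop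
-- positions lower Φ by at most k.  If no branch set lies inside S, each one meeting S
-- has at most r vertices in S and gains one, so Φ grows by the factor (r + 1)/r.  If
-- some Xᵥ lies inside S, every other branch set is adjacent to Xᵥ and gains a vertex
-- unless it is full too; then either at least k − 1 sets are full and Φ(T) ≥ r(k − 1) + h,
-- or Φ grows by at least h − (k − 2) ≥ k.

module Submission where

open import Defs
open import Data.Nat using (ℕ; _≤_; _+_; _*_; _⊓_)
open import Data.Fin.Subset using (Subset)
open import Data.List using (List)

open import Data.Empty using (⊥-elim)
open import Data.Fin using (Fin; zero; suc)
open import Data.Fin.Properties using (any?)
import Data.Fin.Properties as Finₚ
open import Data.Fin.Subset
  using (_∈_; _∉_; _⊆_; _⊈_; _∩_; _∪_; _─_; ⁅_⁆; ∣_∣; ⊤; Nonempty; Empty; inside; outside)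
open import Data.Fin.Subset.Properties
open import Data.List using ([]; _∷_)
open import Data.List.Relation.Unary.All using (All; []; _∷_)
open import Data.Nat using (zero; suc; _∸_; _<_; z≤n; s≤s; s≤s⁻¹)
open import Data.Nat.Properties
open import Data.Nat.Solver using (module +-*-Solver)
open import Algebra.Properties.Semiring.Sum +-*-semiring
  using (sum-syntax; sum-cong-≗; ∑-distrib-+; *-distribˡ-sum)
open import Data.Product using (_×_; _,_; proj₁; proj₂; ∃; ∃-syntax)
open import Data.Sum using (_⊎_; inj₁; inj₂; map₂; [_,_]′)
open import Data.Vec using (_∷_; []; here; there)
open import Function using (_∘_; const)
open import Relation.Binary.PropositionalEquality
  using (_≡_; _≢_; refl; trans; cong; subst; module ≡-Reasoning)
import Relation.Binary.PropositionalEquality as ≡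
open import Relation.Nullary using (¬_; yes; no; contradiction)
open import Relation.Nullary.Decidable using (_×-dec_; ¬?; decidable-stable)

x∈p─q⇒x∉q : ∀ {n} {p q : Subset n} {x} → x ∈ p ─ q → x ∉ q
x∈p─q⇒x∉q {p = _ ∷ _} {outside ∷ _} here      ()
x∈p─q⇒x∉q {p = _ ∷ _} {_ ∷ _}       (there m) (there m′) = x∈p─q⇒x∉q m m′

∣p─q∣+∣p∩q∣≡∣p∣ : ∀ {n} (p q : Subset n) → ∣ p ─ q ∣ + ∣ p ∩ q ∣ ≡ ∣ p ∣
∣p─q∣+∣p∩q∣≡∣p∣ []            []            = refl
∣p─q∣+∣p∩q∣≡∣p∣ (outside ∷ p) (outside ∷ q) = ∣p─q∣+∣p∩q∣≡∣p∣ p q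
∣p─q∣+∣p∩q∣≡∣p∣ (outside ∷ p) (inside ∷ q)  = ∣p─q∣+∣p∩q∣≡∣p∣ p q
∣p─q∣+∣p∩q∣≡∣p∣ (inside ∷ p)  (outside ∷ q) = cong suc (∣p─q∣+∣p∩q∣≡∣p∣ p q)
∣p─q∣+∣p∩q∣≡∣p∣ (inside ∷ p)  (inside ∷ q)  = trans (+-suc _ _) (cong suc (∣p─q∣+∣p∩q∣≡∣p∣ p q))

∩-monoˡ-⊆ : ∀ {n} {p q : Subset n} r → p ⊆ q → p ∩ r ⊆ q ∩ r
∩-monoˡ-⊆ r p⊆q x∈p∩r = let x∈p , x∈r = x∈p∩q⁻ _ r x∈p∩r in x∈p∩q⁺ (p⊆q x∈p , x∈r)

Empty⇒∣p∣≡0 : ∀ {n} {p : Subset n} → Empty p → ∣ p ∣ ≡ 0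
Empty⇒∣p∣≡0 {n} e = trans (cong ∣_∣ (Empty-unique e)) (∣⊥∣≡0 n)

0<∣p∣⇒Nonempty : ∀ {n} (p : Subset n) → 0 < ∣ p ∣ → Nonempty p
0<∣p∣⇒Nonempty p 0<∣p∣ with nonempty? p
... | yes ne = ne
... | no  e  = contradiction (Empty⇒∣p∣≡0 e) (>⇒≢ 0<∣p∣)

Gains : ∀ {n} → Subset n → Subset n → Subset n → Set
Gains S T Y = ∃[ w ] (w ∈ Y × w ∈ T × w ∉ S)

module _ {n} {S T Y : Subset n} where

  Gains⇒∣S∩Y∣<∣T∩Y∣ : S ⊆ T → Gains S T Y → ∣ S ∩ Y ∣ < ∣ T ∩ Y ∣
  Gains⇒∣S∩Y∣<∣T∩Y∣ S⊆T (w , w∈Y , w∈T , w∉S) =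
    p⊂q⇒∣p∣<∣q∣ (∩-monoˡ-⊆ Y S⊆T , w , x∈p∩q⁺ (w∈T , w∈Y) , w∉S ∘ proj₁ ∘ x∈p∩q⁻ S Y)

  Gains⇒∣S∩Y∣<∣Y∣ : Gains S T Y → ∣ S ∩ Y ∣ < ∣ Y ∣
  Gains⇒∣S∩Y∣<∣Y∣ (w , w∈Y , _ , w∉S) =
    p⊂q⇒∣p∣<∣q∣ (p∩q⊆q S Y , w , w∈Y , w∉S ∘ proj₁ ∘ x∈p∩q⁻ S Y)

∑-mono-≤ : ∀ {m} {f g : Fin m → ℕ} → (∀ i → f i ≤ g i) → ∑[ i < m ] f i ≤ ∑[ i < m ] g i
∑-mono-≤ {zero}  _   = z≤n
∑-mono-≤ {suc m} f≤g = +-mono-≤ (f≤g zero) (∑-mono-≤ (f≤g ∘ suc))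

∑-const : ∀ m c → ∑[ i < m ] c ≡ m * c
∑-const zero    c = refl
∑-const (suc m) c = cong (c +_) (∑-const m c)

∑-suc : ∀ m (f : Fin m → ℕ) → ∑[ i < m ] suc (f i) ≡ m + ∑[ i < m ] f i
∑-suc m f = trans (∑-distrib-+ (λ _ → 1) f) (cong (_+ ∑[ i < m ] f i) (trans (∑-const m 1) (*-identityʳ m)))

PairwiseDisjoint : ∀ {N m} → (Fin m → Subset N) → Set
PairwiseDisjoint X = ∀ u v → u ≢ v → ∀ x → x ∈ X u → x ∉ X v

weight : ∀ {N m} → (Fin m → Subset N) → Subset N → ℕ
weight {m = m} X S = ∑[ u < m ] ∣ S ∩ X u ∣

module _ {N m} (X : Fin m → Subset N) where

  weight-─ : ∀ T C → weight X T ≤ weight X (T ─ C) + weight X C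
  weight-─ T C = begin
    weight X T                                          ≤⟨ ∑-mono-≤ split ⟩
    ∑[ u < m ] (∣ (T ─ C) ∩ X u ∣ + ∣ C ∩ X u ∣)        ≡⟨ ∑-distrib-+ (λ u → ∣ (T ─ C) ∩ X u ∣) (λ u → ∣ C ∩ X u ∣) ⟩
    weight X (T ─ C) + weight X C                       ∎
    where
    open ≤-Reasoning
    split : ∀ u → ∣ T ∩ X u ∣ ≤ ∣ (T ─ C) ∩ X u ∣ + ∣ C ∩ X u ∣
    split u = begin
      ∣ T ∩ X u ∣                              ≡⟨ ∣p─q∣+∣p∩q∣≡∣p∣ (T ∩ X u) C ⟨
      ∣ (T ∩ X u) ─ C ∣ + ∣ (T ∩ X u) ∩ C ∣    ≤⟨ +-mono-≤ (p⊆q⇒∣p∣≤∣q∣ out) (p⊆q⇒∣p∣≤∣q∣ in′) ⟩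
      ∣ (T ─ C) ∩ X u ∣ + ∣ C ∩ X u ∣          ∎
      where
      out : (T ∩ X u) ─ C ⊆ (T ─ C) ∩ X u
      out x∈ = let x∈T , x∈X = x∈p∩q⁻ T (X u) (p─q⊆p _ C x∈) in
        x∈p∩q⁺ (x∈p∧x∉q⇒x∈p─q x∈T (x∈p─q⇒x∉q x∈) , x∈X)
      in′ : (T ∩ X u) ∩ C ⊆ C ∩ X u
      in′ x∈ = let x∈TX , x∈C = x∈p∩q⁻ (T ∩ X u) C x∈ in x∈p∩q⁺ (x∈C , p∩q⊆q T (X u) x∈TX)

  weight-─-outside : ∀ C {D} → (∀ u {x} → x ∈ X u → x ∉ D) → weight X C ≤ weight X (C ─ D)
  weight-─-outside C X∩D=∅ = ∑-mono-≤ λ u → p⊆q⇒∣p∣≤∣q∣ λ x∈ →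
    let x∈C , x∈X = x∈p∩q⁻ C (X u) x∈ in x∈p∩q⁺ (x∈p∧x∉q⇒x∈p─q x∈C (X∩D=∅ u x∈X) , x∈X)

weight≤∣∣ : ∀ {N m} (X : Fin m → Subset N) → PairwiseDisjoint X → ∀ C → weight X C ≤ ∣ C ∣
weight≤∣∣ {m = zero}  X disj C = z≤n
weight≤∣∣ {m = suc m} X disj C = begin
  ∣ C ∩ X zero ∣ + weight (X ∘ suc) C              ≤⟨ +-monoʳ-≤ _ (weight-─-outside (X ∘ suc) C away) ⟩
  ∣ C ∩ X zero ∣ + weight (X ∘ suc) (C ─ X zero)   ≤⟨ +-monoʳ-≤ _ (weight≤∣∣ (X ∘ suc) tail-disj (C ─ X zero)) ⟩
  ∣ C ∩ X zero ∣ + ∣ C ─ X zero ∣                  ≡⟨ +-comm ∣ C ∩ X zero ∣ ∣ C ─ X zero ∣ ⟩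
  ∣ C ─ X zero ∣ + ∣ C ∩ X zero ∣                  ≡⟨ ∣p─q∣+∣p∩q∣≡∣p∣ C (X zero) ⟩
  ∣ C ∣                                            ∎
  where
  open ≤-Reasoning
  away : ∀ u {x} → x ∈ X (suc u) → x ∉ X zero
  away u = disj (suc u) zero (λ ()) _
  tail-disj : PairwiseDisjoint (X ∘ suc)
  tail-disj u v u≢v = disj (suc u) (suc v) (u≢v ∘ Finₚ.suc-injective)

weight-⊤ : ∀ {N m} (X : Fin m → Subset N) {s} → (∀ u → ∣ X u ∣ ≡ s) → weight X ⊤ ≡ m * s
weight-⊤ {m = m} X {s} size = begin
  ∑[ u < m ] ∣ ⊤ ∩ X u ∣  ≡⟨ sum-cong-≗ (λ u → trans (cong ∣_∣ (∩-identityˡ (X u))) (size u)) ⟩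
  ∑[ u < m ] s            ≡⟨ ∑-const m s ⟩
  m * s                   ∎
  where open ≡-Reasoning

module _ (G : Graph) where

  ClosedNbhd : Subset (n G) → Fin (n G) → Set
  ClosedNbhd S x = x ∈ S ⊎ ∃[ a ] (a ∈ S × Adj G a x)

  Frontier : Subset (n G) → Subset (n G) → Set
  Frontier S Y = ∃[ w ] (w ∈ Y × w ∉ S × ∃[ a ] (a ∈ S × Adj G a w))

  walk-crosses-frontier : ∀ {S Y a b} → PathIn G Y a b → a ∈ S → b ∉ S → Frontier S Y
  walk-crosses-frontier here a∈S b∉S = contradiction a∈S b∉S
  walk-crosses-frontier {S} (step {c = c} a~c c∈Y walk) a∈S b∉S with c ∈? S
  ... | yes c∈S = walk-crosses-frontier walk c∈S b∉S
  ... | no  c∉S = c , c∈Y , c∉S , _ , a∈S , a~c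

  connected-trichotomy : ∀ S {Y} → Connected G Y → Y ⊆ S ⊎ Empty (S ∩ Y) ⊎ Frontier S Y
  connected-trichotomy S {Y} conn with any? (λ b → (b ∈? Y) ×-dec ¬? (b ∈? S))
  ... | no  Y⊆S = inj₁ λ {b} b∈Y → decidable-stable (b ∈? S) (λ b∉S → Y⊆S (b , b∈Y , b∉S))
  ... | yes (b , b∈Y , b∉S) with nonempty? (S ∩ Y)
  ...   | no  S∩Y=∅       = inj₂ (inj₁ S∩Y=∅)
  ...   | yes (a , a∈S∩Y) = let a∈S , a∈Y = x∈p∩q⁻ S Y a∈S∩Y in
                            inj₂ (inj₂ (walk-crosses-frontier (conn a b a∈Y b∈Y) a∈S b∉S))

  record Extension {m} (S : Subset (n G)) (Y : Fin m → Subset (n G)) (P : Fin m → Set) : Set where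
    field
      T       : Subset (n G)
      S⊆T     : S ⊆ T
      T⊆N[S]  : ∀ {x} → x ∈ T → ClosedNbhd S x
      outcome : ∀ u → P u ⊎ Gains S T (Y u)

  add-frontier-vertices : ∀ {m} S (Y : Fin m → Subset (n G)) (P : Fin m → Set) →
    (∀ u → P u ⊎ Frontier S (Y u)) → Extension S Y P
  add-frontier-vertices {zero} S Y P _ =
    record { T = S ; S⊆T = λ x∈S → x∈S ; T⊆N[S] = inj₁ ; outcome = λ () }
  add-frontier-vertices {suc m} S Y P choice with choice zero
  ... | inj₁ p = record
    { T = T ; S⊆T = S⊆T ; T⊆N[S] = T⊆N[S]
    ; outcome = λ { zero → inj₁ p ; (suc u) → outcome u }
    }
    where open Extension (add-frontier-vertices S (Y ∘ suc) (P ∘ suc) (choice ∘ suc))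
  ... | inj₂ (w , w∈Y , w∉S , a , a∈S , a~w) = record
    { T = ⁅ w ⁆ ∪ T ; S⊆T = T⊆T′ ∘ S⊆T ; T⊆N[S] = T′⊆N[S]
    ; outcome = λ where
        zero    → inj₂ (w , w∈Y , x∈p∪q⁺ (inj₁ (x∈⁅x⁆ w)) , w∉S)
        (suc u) → map₂ (λ (v , v∈Y , v∈T , v∉S) → v , v∈Y , T⊆T′ v∈T , v∉S) (outcome u)
    }
    where
    open Extension (add-frontier-vertices S (Y ∘ suc) (P ∘ suc) (choice ∘ suc))
    T⊆T′ : T ⊆ ⁅ w ⁆ ∪ T
    T⊆T′ = q⊆p∪q ⁅ w ⁆ T
    T′⊆N[S] : ∀ {x} → x ∈ ⁅ w ⁆ ∪ T → ClosedNbhd S x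
    T′⊆N[S] x∈T′ with x∈p∪q⁻ ⁅ w ⁆ T x∈T′
    ... | inj₂ x∈T   = T⊆N[S] x∈T
    ... | inj₁ x∈⁅w⁆ with refl ← x∈⁅y⁆⇒x≡y w x∈⁅w⁆ = inj₂ (a , a∈S , a~w)

  robber-step : ∀ {Cp C A S T} → (∀ {x} → x ∈ S → A x) → (∀ {x} → A x → x ∉ Cp) →
    (∀ {x} → x ∈ T → ClosedNbhd S x) → ∀ {x} → x ∈ T ─ C → nextRegion G Cp A C x
  robber-step {Cp} {C} {T = T} S⊆A A∩Cp=∅ T⊆N[S] x∈T─C with T⊆N[S] (p─q⊆p T C x∈T─C)
  ... | inj₁ x∈S = x∈p─q⇒x∉q x∈T─C , _ , S⊆A x∈S , inj₁ refl
  ... | inj₂ (a , a∈S , a~x) =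
    x∉C , a , S⊆A a∈S , inj₂ (a~x , A∩Cp=∅ (S⊆A a∈S) ∘ proj₁ ∘ x∈p∩q⁻ Cp C , x∉C ∘ proj₂ ∘ x∈p∩q⁻ Cp C)
    where x∉C = x∈p─q⇒x∉q x∈T─C

  copsUsed≤⇒all≤ : ∀ {k} C₁ Cs → copsUsed G C₁ Cs ≤ k → ∣ C₁ ∣ ≤ k × All (λ C → ∣ C ∣ ≤ k) Cs
  copsUsed≤⇒all≤ C₁ []       used≤k = used≤k , []
  copsUsed≤⇒all≤ C₁ (C ∷ Cs) used≤k =
    let ∣C₁∣≤k , bounds = copsUsed≤⇒all≤ C₁ Cs (m⊔n≤o⇒n≤o ∣ C ∣ _ used≤k) in
    ∣C₁∣≤k , m⊔n≤o⇒m≤o ∣ C ∣ _ used≤k ∷ bounds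

  module _ (k : ℕ) (Large : Subset (n G) → Set)
    (Large⇒Nonempty : ∀ {S} → Large S → Nonempty S)
    (expand-robustly : ∀ {S} → Large S →
      ∃[ T ] ((∀ {x} → x ∈ T → ClosedNbhd S x) × (∀ C → ∣ C ∣ ≤ k → Large (T ─ C))))
    where

    robber-survives : ∀ Cp A Cs {S} → (∀ {x} → x ∈ S → A x) → (∀ {x} → A x → x ∉ Cp) →
      All (λ C → ∣ C ∣ ≤ k) Cs → Large S → ∃ (finalRegion G Cp A Cs)
    robber-survives Cp A [] S⊆A _ [] large =
      let x , x∈S = Large⇒Nonempty large in x , S⊆A x∈S
    robber-survives Cp A (C ∷ Cs) S⊆A A∩Cp=∅ (∣C∣≤k ∷ bounds) large =
      let T , T⊆N[S] , robust = expand-robustly large in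
      robber-survives C (nextRegion G Cp A C) Cs (robber-step S⊆A A∩Cp=∅ T⊆N[S]) proj₁ bounds
        (robust C ∣C∣≤k)

    robustly-expanding⇒¬Winning : (∀ C → ∣ C ∣ ≤ k → Large (⊤ ─ C)) →
      ∀ C₁ Cs → copsUsed G C₁ Cs ≤ k → ¬ Winning G C₁ Cs
    robustly-expanding⇒¬Winning start C₁ Cs used≤k win =
      let ∣C₁∣≤k , bounds = copsUsed≤⇒all≤ C₁ Cs used≤k
          x , x∈A = robber-survives C₁ (_∉ C₁) Cs x∈p─q⇒x∉q (λ x∉C₁ → x∉C₁) bounds
                      (start C₁ ∣C₁∣≤k)
      in win x x∈A

threshold : ℕ → ℕ → ℕ
threshold k r = suc ((k ∸ 1) * r)

k*r≤[k∸1]*r+r : ∀ k r → k * r ≤ (k ∸ 1) * r + r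
k*r≤[k∸1]*r+r zero    r = z≤n
k*r≤[k∸1]*r+r (suc k) r = ≤-reflexive (+-comm r (k * r))

threshold-after-growth : ∀ k r {a c} → threshold k r ≤ a → suc r * a ≤ r * c → threshold k r + k ≤ c
threshold-after-growth k r {a} {c} τ≤a ra≤rc = *-cancelˡ-< r (L + k) c (begin-strict
  r * (L + k)           ≡⟨ *-distribˡ-+ r L k ⟩
  r * L + r * k         ≤⟨ +-monoʳ-≤ (r * L) (≤-trans (≤-reflexive (*-comm r k)) (k*r≤[k∸1]*r+r k r)) ⟩
  r * L + (L + r)       <⟨ n<1+n _ ⟩
  suc (r * L + (L + r)) ≡⟨ solve 2 (λ r L → con 1 :+ (r :* L :+ (L :+ r)) := (con 1 :+ r) :* (con 1 :+ L)) refl r L ⟩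
  suc r * suc L         ≤⟨ *-monoʳ-≤ (suc r) τ≤a ⟩
  suc r * a             ≤⟨ ra≤rc ⟩
  r * c                 ∎)
  where
  open ≤-Reasoning
  open +-*-Solver
  L = (k ∸ 1) * r

threshold-after-filling : ∀ k r {a c F h} → threshold k r ≤ a → h + a ≤ F + c → h + r * F ≤ c →
  k < h → k + k ≤ 2 + h → threshold k r + k ≤ c
threshold-after-filling k r {a} {c} {F} {h} τ≤a h+a≤F+c h+rF≤c k<h 2k≤2+h with F + k ≤? h
... | yes F+k≤h = +-cancelˡ-≤ F (suc L + k) c (begin
  F + (suc L + k)  ≡⟨ solve 3 (λ F L k → F :+ (L :+ k) := (F :+ k) :+ L) refl F (suc L) k ⟩
  (F + k) + suc L  ≤⟨ +-mono-≤ F+k≤h τ≤a ⟩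
  h + a            ≤⟨ h+a≤F+c ⟩
  F + c            ∎)
  where
  open ≤-Reasoning
  open +-*-Solver
  L = (k ∸ 1) * r
... | no F+k≰h = begin
  suc L + k        ≡⟨ +-suc L k ⟨
  L + suc k        ≤⟨ +-mono-≤ L≤rF k<h ⟩
  r * F + h        ≡⟨ +-comm (r * F) h ⟩
  h + r * F        ≤⟨ h+rF≤c ⟩
  c                ∎
  where
  open ≤-Reasoning
  L = (k ∸ 1) * r
  k∸1≤F : k ∸ 1 ≤ F
  k∸1≤F = ∸-monoˡ-≤ 1 (s≤s⁻¹ (+-cancelʳ-< k k (2 + F) (≤-<-trans 2k≤2+h (+-monoʳ-< 2 (≰⇒> F+k≰h)))))
  L≤rF : L ≤ r * F
  L≤rF = ≤-trans (*-monoˡ-≤ r k∸1≤F) (≤-reflexive (*-comm F r))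

threshold-initially : ∀ k r {h} → k < h → threshold k r + k ≤ h * suc r
threshold-initially k r {h} k<h = begin
  suc ((k ∸ 1) * r) + k  ≤⟨ +-monoˡ-≤ k (s≤s (*-monoˡ-≤ r (m∸n≤m k 1))) ⟩
  suc (k * r) + k        ≤⟨ m≤m+n _ r ⟩
  suc (k * r) + k + r    ≡⟨ solve 2 (λ k r → con 1 :+ k :* r :+ k :+ r := (con 1 :+ k) :* (con 1 :+ r)) refl k r ⟩
  suc k * suc r          ≤⟨ *-monoˡ-≤ (suc r) k<h ⟩
  h * suc r              ∎
  where
  open ≤-Reasoning
  open +-*-Solver

few-cops : ∀ h k → ¬ ((2 * h) ⊓ (h + 3) ≤ 2 * k) → k < h × k + k ≤ 2 + h
few-cops h k ≰ = *-cancelˡ-< 2 k h (m<n⊓o⇒m<n (2 * h) (h + 3) 2k<) , s≤s⁻¹ (begin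
  suc (k + k)      ≡⟨ cong (λ m → suc (k + m)) (+-identityʳ k) ⟨
  suc (2 * k)      ≤⟨ m<n⊓o⇒m<o (2 * h) (h + 3) 2k< ⟩
  h + 3            ≡⟨ +-comm h 3 ⟩
  3 + h            ∎)
  where
  open ≤-Reasoning
  2k< : 2 * k < (2 * h) ⊓ (h + 3)
  2k< = ≰⇒> ≰

[1+r]*a≤r*t : ∀ {r a t} → a ≤ r → a < t → suc r * a ≤ r * t
[1+r]*a≤r*t {r} {a} {t} a≤r a<t = begin
  suc r * a  ≤⟨ +-monoˡ-≤ (r * a) a≤r ⟩
  r + r * a  ≡⟨ *-suc r a ⟨
  r * suc a  ≤⟨ *-monoʳ-≤ r a<t ⟩
  r * t      ∎
  where open ≤-Reasoning

module _ (G : Graph) {h} (M : KMinorModel G h) {r} (size : ∀ u → ∣ KMinorModel.X M u ∣ ≡ suc r) where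
  open KMinorModel M

  Expansion : ℕ → Subset (n G) → Set
  Expansion k S = ∃[ T ] ((∀ {x} → x ∈ T → ClosedNbhd G S x) × threshold k r + k ≤ weight X T)

  expand-with-full : ∀ {k S v} → X v ⊆ S → k < h → k + k ≤ 2 + h →
    threshold k r ≤ weight X S → Expansion k S
  expand-with-full {k} {S} {v} X[v]⊆S k<h 2k≤2+h large =
    T , T⊆N[S] , threshold-after-filling k r large grown filled k<h 2k≤2+h
    where
    full-or-frontier : ∀ u → X u ⊆ S ⊎ Frontier G S (X u)
    full-or-frontier u with v Finₚ.≟ u
    ... | yes refl = inj₁ X[v]⊆S
    ... | no  v≢u with connected-trichotomy G S (connected u)
    ...   | inj₁ X[u]⊆S         = inj₁ X[u]⊆S
    ...   | inj₂ (inj₂ frontier) = inj₂ frontier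
    ...   | inj₂ (inj₁ S∩X[u]=∅) =
      let x , y , x∈X[v] , y∈X[u] , x~y = adjacent v u v≢u in
      inj₂ (y , y∈X[u] , (λ y∈S → S∩X[u]=∅ (y , x∈p∩q⁺ (y∈S , y∈X[u]))) , x , X[v]⊆S x∈X[v] , x~y)

    open Extension (add-frontier-vertices G S X (λ u → X u ⊆ S) full-or-frontier)

    full : Fin h → ℕ
    full u = [ const 1 , const 0 ]′ (outcome u)

    #full : ℕ
    #full = ∑[ u < h ] full u

    grown-at : ∀ u → suc ∣ S ∩ X u ∣ ≤ full u + ∣ T ∩ X u ∣
    grown-at u with outcome u
    ... | inj₁ _     = s≤s (p⊆q⇒∣p∣≤∣q∣ (∩-monoˡ-⊆ (X u) S⊆T))
    ... | inj₂ gains = Gains⇒∣S∩Y∣<∣T∩Y∣ S⊆T gains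

    filled-at : ∀ u → suc (r * full u) ≤ ∣ T ∩ X u ∣
    filled-at u with outcome u
    ... | inj₁ X[u]⊆S = begin
      suc (r * 1)   ≡⟨ cong suc (*-identityʳ r) ⟩
      suc r         ≡⟨ size u ⟨
      ∣ X u ∣       ≤⟨ p⊆q⇒∣p∣≤∣q∣ (λ x∈X[u] → x∈p∩q⁺ (S⊆T (X[u]⊆S x∈X[u]) , x∈X[u])) ⟩
      ∣ T ∩ X u ∣   ∎
      where open ≤-Reasoning
    ... | inj₂ gains = begin
      suc (r * 0)      ≡⟨ cong suc (*-zeroʳ r) ⟩
      1                ≤⟨ s≤s z≤n ⟩
      suc ∣ S ∩ X u ∣  ≤⟨ Gains⇒∣S∩Y∣<∣T∩Y∣ S⊆T gains ⟩
      ∣ T ∩ X u ∣      ∎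
      where open ≤-Reasoning

    grown : h + weight X S ≤ #full + weight X T
    grown = begin
      h + weight X S                          ≡⟨ ∑-suc h (λ u → ∣ S ∩ X u ∣) ⟨
      ∑[ u < h ] suc ∣ S ∩ X u ∣              ≤⟨ ∑-mono-≤ grown-at ⟩
      ∑[ u < h ] (full u + ∣ T ∩ X u ∣)       ≡⟨ ∑-distrib-+ full (λ u → ∣ T ∩ X u ∣) ⟩
      #full + weight X T                      ∎
      where open ≤-Reasoning

    filled : h + r * #full ≤ weight X T
    filled = begin
      h + r * #full                           ≡⟨ cong (h +_) (*-distribˡ-sum r full) ⟩
      h + ∑[ u < h ] (r * full u)             ≡⟨ ∑-suc h (λ u → r * full u) ⟨
      ∑[ u < h ] suc (r * full u)             ≤⟨ ∑-mono-≤ filled-at ⟩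
      weight X T                              ∎
      where open ≤-Reasoning

  expand-without-full : ∀ {k S} → (∀ v → X v ⊈ S) → threshold k r ≤ weight X S → Expansion k S
  expand-without-full {k} {S} none-full large =
    T , T⊆N[S] , threshold-after-growth k r large grown
    where
    avoided-or-frontier : ∀ u → Empty (S ∩ X u) ⊎ Frontier G S (X u)
    avoided-or-frontier u with connected-trichotomy G S (connected u)
    ... | inj₁ X[u]⊆S  = ⊥-elim (none-full u X[u]⊆S)
    ... | inj₂ outcome = outcome

    open Extension (add-frontier-vertices G S X (λ u → Empty (S ∩ X u)) avoided-or-frontier)

    grown-at : ∀ u → suc r * ∣ S ∩ X u ∣ ≤ r * ∣ T ∩ X u ∣
    grown-at u with outcome u
    ... | inj₁ S∩X[u]=∅ rewrite Empty⇒∣p∣≡0 S∩X[u]=∅ | *-zeroʳ r = z≤n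
    ... | inj₂ gains    = [1+r]*a≤r*t (s≤s⁻¹ (subst (∣ S ∩ X u ∣ <_) (size u) (Gains⇒∣S∩Y∣<∣Y∣ gains)))
                                      (Gains⇒∣S∩Y∣<∣T∩Y∣ S⊆T gains)

    grown : suc r * weight X S ≤ r * weight X T
    grown = begin
      suc r * weight X S                  ≡⟨ *-distribˡ-sum (suc r) (λ u → ∣ S ∩ X u ∣) ⟩
      ∑[ u < h ] (suc r * ∣ S ∩ X u ∣)    ≤⟨ ∑-mono-≤ grown-at ⟩
      ∑[ u < h ] (r * ∣ T ∩ X u ∣)        ≡⟨ *-distribˡ-sum r (λ u → ∣ T ∩ X u ∣) ⟨
      r * weight X T                      ∎
      where open ≤-Reasoning

  expand : ∀ {k S} → k < h → k + k ≤ 2 + h → threshold k r ≤ weight X S → Expansion k S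
  expand {k} {S} k<h 2k≤2+h large with any? (λ v → X v ⊆? S)
  ... | yes (v , X[v]⊆S) = expand-with-full X[v]⊆S k<h 2k≤2+h large
  ... | no  none-full    = expand-without-full {k} (λ v X[v]⊆S → none-full (v , X[v]⊆S)) large

  survives-removal : ∀ {k} T → threshold k r + k ≤ weight X T →
    ∀ C → ∣ C ∣ ≤ k → threshold k r ≤ weight X (T ─ C)
  survives-removal {k} T big C ∣C∣≤k = +-cancelʳ-≤ k (threshold k r) (weight X (T ─ C)) (begin
    threshold k r + k               ≤⟨ big ⟩
    weight X T                      ≤⟨ weight-─ X T C ⟩
    weight X (T ─ C) + weight X C   ≤⟨ +-monoʳ-≤ (weight X (T ─ C)) (≤-trans (weight≤∣∣ X disjoint C) ∣C∣≤k) ⟩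
    weight X (T ─ C) + k            ∎)
    where open ≤-Reasoning

  minor⇒¬Winning : ∀ {k} → k < h → k + k ≤ 2 + h → ∀ C₁ Cs → copsUsed G C₁ Cs ≤ k → ¬ Winning G C₁ Cs
  minor⇒¬Winning {k} k<h 2k≤2+h =
    robustly-expanding⇒¬Winning G k Large large⇒nonempty expand-robustly initially-large
    where
    Large : Subset (n G) → Set
    Large S = threshold k r ≤ weight X S
    large⇒nonempty : ∀ {S} → Large S → Nonempty S
    large⇒nonempty {S} large = 0<∣p∣⇒Nonempty S (≤-trans (s≤s z≤n) (≤-trans large (weight≤∣∣ X disjoint S)))
    expand-robustly : ∀ {S} → Large S →
      ∃[ T ] ((∀ {x} → x ∈ T → ClosedNbhd G S x) × (∀ C → ∣ C ∣ ≤ k → Large (T ─ C)))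
    expand-robustly large = let T , T⊆N[S] , big = expand k<h 2k≤2+h large in T , T⊆N[S] , survives-removal T big
    initially-large : ∀ C → ∣ C ∣ ≤ k → Large (⊤ ─ C)
    initially-large = survives-removal ⊤ (≤-trans (threshold-initially k r k<h) (≤-reflexive (≡.sym (weight-⊤ X size))))

balanced⇒uniform-size : ∀ {G h} → 0 < h → (bm : BalancedKMinor G h) →
  ∃[ r ] (∀ u → ∣ KMinorModel.X (proj₁ bm) u ∣ ≡ suc r)
balanced⇒uniform-size {h = suc _} _ (M , balanced)
  with ∣ KMinorModel.X M zero ∣ in eq | x∈p⇒∣p-x∣<∣p∣ (proj₂ (KMinorModel.nonempty M zero))
... | suc r | _ = r , λ u → trans (balanced u zero) eq

proposition4p4 : (G : Graph) (h : ℕ) → BalancedKMinor G h →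
    (C₁ : Subset (n G)) (Cs : List (Subset (n G))) → Winning G C₁ Cs →
    (2 * h) ⊓ (h + 3) ≤ 2 * copsUsed G C₁ Cs
proposition4p4 G h (M , balanced) C₁ Cs win with (2 * h) ⊓ (h + 3) ≤? 2 * copsUsed G C₁ Cs
... | yes enough    = enough
... | no not-enough =
  let k<h , 2k≤2+h = few-cops h (copsUsed G C₁ Cs) not-enough
      r , size     = balanced⇒uniform-size (≤-trans (s≤s z≤n) k<h) (M , balanced)
  in ⊥-elim (minor⇒¬Winning G M size k<h 2k≤2+h C₁ Cs ≤-refl win)
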